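{- Let $T$ be a tree of order $n$ with matching number $\beta$. Then there exists a matching $M=\{u_1v_1,u_2v_2,\dots,u_\beta v_\beta\}$ of $T$ with $\beta$ edges such that the subgraph $T[U]$ of $T$ induced by $U=\bigcup_{i=1}^{\beta}\{u_i,v_i\}$ is a tree.
   Context: The matching number of a graph is the maximum number of pairwise disjoint edges in it. -}

module Defs where

open import Data.Nat using (ℕ; _≤_)
open import Data.Fin using (Fin)
open import Data.Bool using (Bool; true; false)
open import Data.List using (List; []; _∷_; _++_; [_]; length; head; last; concatMap)
open import Data.List.Relation.Unary.All using (All)
open import Data.List.Relation.Unary.Unique.Propositional using (Unique)
open import Data.List.Membership.Propositional using (_∈_)
open import Data.Maybe using (Maybe; just)
open import Data.Product using (Σ; _×_; _,_)
open import Data.Unit using (⊤)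
open import Relation.Nullary using (¬_)
open import Relation.Binary.PropositionalEquality using (_≡_)

record Graph (n : ℕ) : Set where
  field
    adj    : Fin n → Fin n → Bool
    sym    : ∀ u v → adj u v ≡ adj v u
    irrefl : ∀ v → adj v v ≡ false
open Graph public

module _ {n : ℕ} (G : Graph n) where

  Chain : List (Fin n) → Set
  Chain []           = ⊤
  Chain (x ∷ [])     = ⊤
  Chain (x ∷ y ∷ xs) = (adj G x y ≡ true) × Chain (y ∷ xs)

  ConnectedOn : (Fin n → Set) → Set
  ConnectedOn P = ∀ u v → P u → P v →
    Σ (List (Fin n)) λ xs →
      Chain xs × All P xs × head xs ≡ just u × last xs ≡ just v

  CycleOn : (Fin n → Set) → Set
  CycleOn P = Σ (Fin n) λ u → Σ (List (Fin n)) λ xs →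
    2 ≤ length xs × Unique (u ∷ xs) × All P (u ∷ xs) × Chain (u ∷ xs ++ [ u ])

  AcyclicOn : (Fin n → Set) → Set
  AcyclicOn P = ¬ CycleOn P

  IsTreeOn : (Fin n → Set) → Set
  IsTreeOn P = ConnectedOn P × AcyclicOn P

  IsTree : Set
  IsTree = IsTreeOn (λ _ → ⊤)

  endpoints : List (Fin n × Fin n) → List (Fin n)
  endpoints = concatMap (λ { (u , v) → u ∷ v ∷ [] })

  IsMatching : List (Fin n × Fin n) → Set
  IsMatching M = All (λ { (u , v) → adj G u v ≡ true }) M × Unique (endpoints M)

  IsMatchingNumber : ℕ → Set
  IsMatchingNumber β =
    (Σ (List (Fin n × Fin n)) λ M → IsMatching M × length M ≡ β) ×
    (∀ M → IsMatching M → length M ≤ β)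

{-# OPTIONS --safe #-}
-- Root the tree at r and let h be the distance to r. Call a vertex u covered by a matching M
-- anchored if u = r or u has a covered neighbour closer to r. If every covered vertex is
-- anchored, descending through covered neighbours leads from each of them to r, so the covered
-- vertices induce a connected subgraph, hence a subtree. Otherwise take an unanchored u, its
-- partner u' and its neighbour p towards r: p is uncovered and h p < h u ≤ h u', so replacing
-- uu' by up keeps the size of M and lowers the total height of the covered vertices.
module Submission where

open import Defs
open import Data.Nat using (ℕ; zero; suc; _+_; _≤_; _<_; z≤n; s≤s; _<?_)
open import Data.Nat.Properties using (<-≤-trans; ≮⇒≥; +-monoˡ-<; +-monoʳ-<; module ≤-Reasoning)
open import Data.Nat.Induction using (<-wellFounded)
open import Data.Nat.ListAction using (sum)
open import Data.Nat.ListAction.Properties using (sum-↭)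
open import Data.Fin using (Fin) renaming (_≟_ to _≟ᶠ_)
import Data.Fin.Properties as Fin
open import Data.Bool using (true)
open import Data.Bool.Properties using () renaming (_≟_ to _≟ᵇ_)
open import Data.List using (List; []; _∷_; [_]; head; last; length; map)
open import Data.List.Membership.Propositional using (_∈_; _∉_; find; lose)
open import Data.List.Relation.Unary.All as All using (All; []; _∷_; all?)
open import Data.List.Relation.Unary.All.Properties using (¬All⇒Any¬; ¬Any⇒All¬)
open import Data.List.Relation.Unary.Any as Any using (Any; here; there)
open import Data.List.Relation.Unary.AllPairs using (_∷_)
open import Data.List.Relation.Unary.Unique.Propositional using (Unique)
open import Data.List.Relation.Binary.Permutation.Propositional
  using (_↭_; ↭-refl; ↭-sym; ↭-trans; prep; swap; ↭⇒↭ₛ)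
open import Data.List.Relation.Binary.Permutation.Propositional.Properties
  using (∈-resp-↭; shifts; map⁺)
import Data.List.Relation.Binary.Permutation.Setoid.Properties as Permutationₛ
open import Data.Maybe using (just)
open import Data.Product using (Σ; ∃-syntax; _×_; _,_; proj₁; proj₂)
open import Data.Sum using (_⊎_; inj₁; inj₂)
open import Data.Unit using (⊤; tt)
open import Data.Empty using (⊥-elim)
open import Function using (_∘_)
open import Induction.WellFounded using (Acc; acc)
open import Relation.Binary.Core using (Rel)
open import Relation.Binary.Definitions using (Sym)
open import Relation.Binary.Construct.Closure.ReflexiveTransitive using (Star; ε; _◅_; _◅◅_; reverse)
open import Relation.Binary.PropositionalEquality using (_≡_; _≢_; refl; trans; cong; setoid)
import Relation.Binary.PropositionalEquality as ≡
open import Relation.Nullary using (¬_; Dec; yes; no)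
open import Relation.Nullary.Decidable using (_×-dec_; _⊎-dec_)
open import Relation.Unary using (Decidable)

least-witness : ∀ {P : ℕ → Set} → Decidable P → ∀ {k} → P k →
  Σ ℕ λ m → P m × (∀ {j} → P j → m ≤ j)
least-witness P? {zero} p0 = 0 , p0 , λ _ → z≤n
least-witness P? {suc k} pk with P? 0
... | yes p0 = 0 , p0 , λ _ → z≤n
... | no ¬p0 with least-witness (P? ∘ suc) pk
... | m , pm , minimal = suc m , pm , λ { {zero} p0 → ⊥-elim (¬p0 p0) ; {suc j} pj → s≤s (minimal pj) }

Unique-resp-↭ : ∀ {A : Set} {xs ys : List A} → xs ↭ ys → Unique xs → Unique ys
Unique-resp-↭ {A} σ = Permutationₛ.Unique-resp-↭ (setoid A) (↭⇒↭ₛ σ)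

module _ {n : ℕ} (G : Graph n) where

  InducedAdj : (Fin n → Set) → Rel (Fin n) _
  InducedAdj P u v = P u × P v × adj G u v ≡ true

  InducedAdj-sym : ∀ {P} → Sym (InducedAdj P) (InducedAdj P)
  InducedAdj-sym {x = u} {y = v} (pu , pv , u~v) = pv , pu , trans (sym G v u) u~v

  walk⇒chain : ∀ {P u v} → P u → Star (InducedAdj P) u v →
    Σ (List (Fin n)) λ xs → Chain G xs × All P xs × head xs ≡ just u × last xs ≡ just v
  walk⇒chain {u = u} pu ε = [ u ] , tt , pu ∷ [] , refl , refl
  walk⇒chain {u = u} pu ((_ , pw , u~w) ◅ walk) with walk⇒chain pw walk
  ... | [] , _ , _ , () , _
  ... | x ∷ xs , chain , all , refl , end = u ∷ x ∷ xs , (u~w , chain) , pu ∷ all , refl , end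

  connectedOn-viaHub : ∀ {P} r → (∀ {u} → P u → Star (InducedAdj P) u r) → ConnectedOn G P
  connectedOn-viaHub r toHub u v pu pv =
    walk⇒chain pu (toHub pu ◅◅ reverse InducedAdj-sym (toHub pv))

  acyclic⇒acyclicOn : AcyclicOn G (λ _ → ⊤) → ∀ P → AcyclicOn G P
  acyclic⇒acyclicOn acyclic P (u , xs , long , distinct , _ , closed) =
    acyclic (u , xs , long , distinct , All.universal (λ _ → tt) _ , closed)

  IsHeight : Fin n → (Fin n → ℕ) → Set
  IsHeight r h = ∀ {v} → v ≢ r → Σ (Fin n) λ w → adj G v w ≡ true × h w < h v

  data Within (r : Fin n) : ℕ → Fin n → Set where
    root : ∀ {k} → Within r k r
    step : ∀ {k v w} → adj G v w ≡ true → Within r k w → Within r (suc k) v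

  within? : ∀ r k v → Dec (Within r k v)
  within? r k v with v ≟ᶠ r
  ... | yes refl = yes root
  within? r zero v | no v≢r = no λ { root → v≢r refl }
  within? r (suc k) v | no v≢r with Fin.any? (λ w → (adj G v w ≟ᵇ true) ×-dec within? r k w)
  ... | yes (w , v~w , wk) = yes (step v~w wk)
  ... | no ¬step = no λ { root → v≢r refl ; (step v~w wk) → ¬step (_ , v~w , wk) }

  chain⇒within : ∀ {r} x xs → Chain G (x ∷ xs) → last (x ∷ xs) ≡ just r → ∃[ k ] Within r k x
  chain⇒within x [] _ refl = 0 , root
  chain⇒within x (y ∷ ys) (x~y , chain) end =
    let k , wy = chain⇒within y ys chain end in suc k , step x~y wy

  connected⇒height : ConnectedOn G (λ _ → ⊤) → ∀ r → Σ (Fin n → ℕ) (IsHeight r)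
  connected⇒height connected r = h , descend
    where
      reachable : ∀ v → ∃[ k ] Within r k v
      reachable v with connected v r tt tt
      ... | [] , _ , _ , () , _
      ... | x ∷ xs , chain , _ , refl , end = chain⇒within x xs chain end

      distance : ∀ v → Σ ℕ λ m → Within r m v × (∀ {j} → Within r j v → m ≤ j)
      distance v = least-witness (λ k → within? r k v) (proj₂ (reachable v))

      h : Fin n → ℕ
      h v = proj₁ (distance v)

      towards : ∀ {v m} → v ≢ r → Within r m v → Σ (Fin n) λ w → adj G v w ≡ true × h w < m
      towards v≢r root = ⊥-elim (v≢r refl)
      towards _ (step {w = w} v~w wk) = w , v~w , s≤s (proj₂ (proj₂ (distance w)) wk)

      descend : IsHeight r h
      descend {v} v≢r = towards v≢r (proj₁ (proj₂ (distance v)))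

  ConnectedMatching : ℕ → Set
  ConnectedMatching k = Σ (List (Fin n × Fin n)) λ M →
    IsMatching G M × length M ≡ k × ConnectedOn G (_∈ endpoints G M)

  IsMatching-flip : ∀ {a b M} → IsMatching G ((a , b) ∷ M) → IsMatching G ((b , a) ∷ M)
  IsMatching-flip {a} {b} (a~b ∷ edges , distinct) =
    trans (sym G b a) a~b ∷ edges , Unique-resp-↭ (swap a b ↭-refl) distinct

  partner : ∀ {M u} → IsMatching G M → u ∈ endpoints G M →
    Σ (Fin n) λ u' → Σ (List (Fin n × Fin n)) λ M₀ →
      IsMatching G ((u , u') ∷ M₀) × length M ≡ suc (length M₀) ×
      endpoints G M ↭ u ∷ u' ∷ endpoints G M₀
  partner {(a , b) ∷ M} matching (here refl) = b , M , matching , refl , ↭-refl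
  partner {(a , b) ∷ M} matching (there (here refl)) =
    a , M , IsMatching-flip matching , refl , swap a b ↭-refl
  partner {(a , b) ∷ M} (a~b ∷ edges , distinct@(_ ∷ _ ∷ distinct')) (there (there u∈))
    with partner (edges , distinct') u∈
  ... | u' , M₀ , (u~u' ∷ edges₀ , _) , len , σ =
    u' , (a , b) ∷ M₀ , (u~u' ∷ a~b ∷ edges₀ , Unique-resp-↭ τ distinct) , cong suc len , τ
    where τ = ↭-trans (prep a (prep b σ)) (shifts (a ∷ b ∷ []) (_ ∷ u' ∷ []))

  IsMatching-rematch : ∀ {u u' p M} → IsMatching G ((u , u') ∷ M) →
    p ∉ endpoints G ((u , u') ∷ M) → adj G u p ≡ true → IsMatching G ((u , p) ∷ M)
  IsMatching-rematch (_ ∷ edges , ((_ ∷ u∉M) ∷ _ ∷ distinct)) p∉ u~p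
    with ¬Any⇒All¬ _ p∉
  ... | p≢u ∷ _ ∷ p∉M = u~p ∷ edges , ((p≢u ∘ ≡.sym) ∷ u∉M) ∷ p∉M ∷ distinct

module Rooted {n} (G : Graph n) (r : Fin n) (h : Fin n → ℕ) (descend : IsHeight G r h) where

  weight : List (Fin n × Fin n) → ℕ
  weight M = sum (map h (endpoints G M))

  Anchored : List (Fin n × Fin n) → Fin n → Set
  Anchored M u = u ≡ r ⊎ Any (λ w → adj G u w ≡ true × h w < h u) (endpoints G M)

  anchored? : ∀ M → Decidable (Anchored M)
  anchored? M u =
    (u ≟ᶠ r) ⊎-dec Any.any? (λ w → (adj G u w ≟ᵇ true) ×-dec (h w <? h u)) (endpoints G M)

  anchored⇒walk : ∀ {M u} → All (Anchored M) (endpoints G M) → u ∈ endpoints G M →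
    Acc _<_ (h u) → Star (InducedAdj G (_∈ endpoints G M)) u r
  anchored⇒walk {M} anchored u∈ (acc rs) with All.lookup anchored u∈
  ... | inj₁ refl = ε
  ... | inj₂ lower with find lower
  ... | w , w∈ , u~w , hw<hu = (u∈ , w∈ , u~w) ◅ anchored⇒walk {M} anchored w∈ (rs hw<hu)

  anchored⇒connected : ∀ {M} → All (Anchored M) (endpoints G M) → ConnectedOn G (_∈ endpoints G M)
  anchored⇒connected {M} anchored =
    connectedOn-viaHub G r (λ u∈ → anchored⇒walk {M} anchored u∈ (<-wellFounded _))

  unanchored⇒lighter : ∀ {M u} → IsMatching G M → u ∈ endpoints G M → ¬ Anchored M u →
    Σ (List (Fin n × Fin n)) λ M' → IsMatching G M' × length M' ≡ length M × weight M' < weight M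
  unanchored⇒lighter {M} {u} matching u∈ unanchored
    with descend (unanchored ∘ inj₁) | partner G matching u∈
  ... | p , u~p , hp<hu | u' , M₀ , matching₀@(u~u' ∷ _ , _) , len , σ =
    (u , p) ∷ M₀ , IsMatching-rematch G matching₀ p∉ u~p , ≡.sym len , lighter
    where
      u'∈ : u' ∈ endpoints G M
      u'∈ = ∈-resp-↭ (↭-sym σ) (there (here refl))

      p∉ : p ∉ u ∷ u' ∷ endpoints G M₀
      p∉ p∈ = unanchored (inj₂ (lose (∈-resp-↭ (↭-sym σ) p∈) (u~p , hp<hu)))

      hu≤hu' : h u ≤ h u'
      hu≤hu' = ≮⇒≥ λ hu'<hu → unanchored (inj₂ (lose u'∈ (u~u' , hu'<hu)))

      open ≤-Reasoning

      lighter : weight ((u , p) ∷ M₀) < weight M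
      lighter = begin-strict
        h u + (h p + weight M₀)  <⟨ +-monoʳ-< (h u) (+-monoˡ-< (weight M₀) (<-≤-trans hp<hu hu≤hu')) ⟩
        h u + (h u' + weight M₀) ≡⟨ sum-↭ (map⁺ h (↭-sym σ)) ⟩
        weight M                 ∎

  connectMatching : ∀ {M} → IsMatching G M → Acc _<_ (weight M) → ConnectedMatching G (length M)
  connectMatching {M} matching (acc rs) with all? (anchored? M) (endpoints G M)
  ... | yes anchored = M , matching , refl , anchored⇒connected {M} anchored
  ... | no ¬anchored with find (¬All⇒Any¬ (anchored? M) _ ¬anchored)
  ... | u , u∈ , unanchored with unanchored⇒lighter matching u∈ unanchored
  ... | M' , matching' , len' , lighter with connectMatching {M'} matching' (rs lighter)
  ... | M'' , matching'' , len'' , connected = M'' , matching'' , trans len'' len' , connected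

connected⇒connectedMatching : ∀ {n} (G : Graph n) → ConnectedOn G (λ _ → ⊤) →
  ∀ {M} → IsMatching G M → ConnectedMatching G (length M)
connected⇒connectedMatching G connected {[]} matching = [] , matching , refl , λ _ _ ()
connected⇒connectedMatching G connected {(r , _) ∷ _} matching =
  let h , descend = connected⇒height G connected r
  in Rooted.connectMatching G r h descend matching (<-wellFounded _)

theorem2p2 : ∀ {n : ℕ} (T : Graph n) (β : ℕ) → IsTree T → IsMatchingNumber T β →
    Σ (List (Fin n × Fin n)) λ M →
      IsMatching T M × length M ≡ β × IsTreeOn T (λ w → w ∈ endpoints T M)
theorem2p2 T β (connected , acyclic) ((M , matching , refl) , _) =
  let M' , matching' , len , connected' = connected⇒connectedMatching T connected matching
  in M' , matching' , len , connected' , acyclic⇒acyclicOn T acyclic _
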